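{- Let $(N,T,f)$ be a linear game ladder. Then $\succeq$ is a complete preorder on $N$ (complete, reflexive and transitive), and $\succ$ is a finite union of tournaments.
   Context: A game ladder is a triple $(N,T,f)$ where $N=\{1,\dots,n\}$ is a non-empty finite set of players, $T=\{1,\dots,m\}$ with $m\ge 2$ is an ordered set of positions (higher index = more important position), and $f:T^N\to\mathbb{R}$ is monotonic: for all $x,z\in T^N$ with $x\le z$ componentwise, $f(x)\le f(z)$. For $p\in N$, $e^p$ denotes the $p$-th unit vector. For players $p,q$ and positions $r>s$ in $T$, write $p\succeq_{(r,s)}q$ if for every $x\in T^N$ with $x_p=x_q=s$ one has $f(x+(r-s)e^p)\ge f(x+(r-s)e^q)$. Write $p\succeq q$ if $p\succeq_{(r,s)}q$ for all $r,s\in T$ with $r>s$; $p\succ q$ means $p\succeq q$ and not $q\succeq p$. The game ladder is linear if $\succeq$ is complete, i.e. for all $p,q\in N$, $p\succeq q$ or $q\succeq p$. A tournament is a binary relation that is complete and asymmetric (on the set of elements it relates); "$\succ$ is a finite union of tournaments" means $\succ$ equals the union of finitely many such relations. -}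

module Defs where

open import Level using (Level; _⊔_)
open import Data.Nat using (ℕ)
open import Data.Fin using (Fin) renaming (_≤_ to _≤ᶠ_; _<_ to _<ᶠ_)
open import Data.Vec.Functional using (updateAt)
open import Data.Product using (Σ; ∃; ∃-syntax; _×_; _,_)
open import Data.Sum using (_⊎_)
open import Function using (const)
open import Relation.Nullary using (¬_)
open import Relation.Binary.Core using (Rel)
open import Relation.Binary.Bundles using (TotalOrder)
open import Relation.Binary.Definitions using (Total; Reflexive; Transitive; Asymmetric)
open import Relation.Binary.PropositionalEquality using (_≡_; _≢_)

-- Strategy profiles x ∈ T^N with N = Fin n (players), T = Fin m (positions,
-- higher index = more important position).
Profile : ℕ → ℕ → Set
Profile n m = Fin n → Fin m

_≤ᵖ_ : ∀ {n m} → Profile n m → Profile n m → Set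
x ≤ᵖ z = ∀ i → x i ≤ᶠ z i

-- x + (r - s) e^p, for x with x p = s: the profile x with entry p moved to r.
move : ∀ {n m} → Profile n m → Fin n → Fin m → Profile n m
move x p r = updateAt x p (const r)

module _ {c ℓ₁ ℓ₂} (O : TotalOrder c ℓ₁ ℓ₂) {n m : ℕ} where
  open TotalOrder O renaming (Carrier to V; _≤_ to _≤ᵥ_)

  Monotonic : (Profile n m → V) → Set ℓ₂
  Monotonic f = ∀ x z → x ≤ᵖ z → f x ≤ᵥ f z

  DomAt : (Profile n m → V) → Fin m → Fin m → Fin n → Fin n → Set ℓ₂
  DomAt f r s p q = ∀ (x : Profile n m) → x p ≡ s → x q ≡ s →
                    f (move x q r) ≤ᵥ f (move x p r)

  Dom : (Profile n m → V) → Rel (Fin n) ℓ₂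
  Dom f p q = ∀ (r s : Fin m) → s <ᶠ r → DomAt f r s p q

  SDom : (Profile n m → V) → Rel (Fin n) ℓ₂
  SDom f p q = Dom f p q × ¬ Dom f q p

  Linear : (Profile n m → V) → Set ℓ₂
  Linear f = Total (Dom f)

IsCompletePreorder : ∀ {a ℓ} {A : Set a} → Rel A ℓ → Set (a ⊔ ℓ)
IsCompletePreorder R = Total R × Reflexive R × Transitive R

InField : ∀ {a ℓ} {A : Set a} → Rel A ℓ → A → Set (a ⊔ ℓ)
InField R x = ∃[ y ] (R x y ⊎ R y x)

IsTournament : ∀ {a ℓ} {A : Set a} → Rel A ℓ → Set (a ⊔ ℓ)
IsTournament R = Asymmetric R ×
  (∀ x y → InField R x → InField R y → x ≢ y → R x y ⊎ R y x)

FiniteUnionOfTournaments : ∀ {a ℓ} {A : Set a} → Rel A ℓ → Set (Level.suc ℓ ⊔ a)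
FiniteUnionOfTournaments {a} {ℓ} {A} S =
  ∃[ k ] Σ (Fin k → Rel A ℓ) λ R →
    (∀ i → IsTournament (R i)) ×
    (∀ x y → (S x y → ∃[ i ] R i x y) × (∃[ i ] R i x y → S x y))

-- Write p ⪰ₓ q (ExchangeDom) when, in every profile, moving the higher of two positions from q
-- to p does not lower f.  For distinct players ⪰ coincides with ⪰ₓ: the two profiles compared in
-- the definition of p ⪰_(r,s) q are exactly such an exchange.  Along a cycle p ⪰ₓ q ⪰ₓ t ⪰ₓ p of
-- three players we get p ⪰ₓ t, because the transposition of the positions of p and t factors into
-- three transpositions along the cycle, each taken in a direction that does not raise f.
-- Linearity supplies t ⪰ p whenever p ⪰ t fails, so ⪰ is transitive.  Finally ≻ is irreflexive,
-- so it is the union of its edges, each of which is a tournament on two elements.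
module Submission where

open import Defs
open import Data.Nat using (ℕ; _≤_; _*_)
open import Data.Fin using (Fin; _≟_; combine; remQuot) renaming (_≤_ to _≤ᶠ_)
import Data.Fin.Properties as Fin
open import Data.Nat.Properties using (<⇒≤)
open import Data.Vec.Functional.Properties
  using (updateAt-updates; updateAt-minimal; updateAt-id-local; updateAt-updateAt-local; updateAt-commutes)
open import Data.Product using (∃-syntax; _×_; _,_; uncurry)
open import Data.Sum using (_⊎_; inj₁; inj₂)
open import Data.Empty using (⊥-elim)
open import Function using (_∘_)
open import Level using (_⊔_)
open import Relation.Nullary using (¬_; yes; no)
open import Relation.Binary.Core using (Rel)
open import Relation.Binary.Bundles using (TotalOrder; TotalPreorder; Preorder)
open import Relation.Binary.Definitions using (Reflexive; Transitive)
open import Relation.Binary.PropositionalEquality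
  using (_≡_; _≢_; _≗_; refl; sym; trans; subst)
import Relation.Binary.Reasoning.Preorder as PreorderReasoning

module _ {a b ℓ₁ ℓ₂ ℓ₃ ℓ₄} (A : TotalPreorder a ℓ₁ ℓ₂) (V : Preorder b ℓ₃ ℓ₄)
         (g : TotalPreorder.Carrier A → TotalPreorder.Carrier A → TotalPreorder.Carrier A →
              Preorder.Carrier V) where
  open TotalPreorder A using (total) renaming (_≲_ to _≤ₐ_; trans to ≤ₐ-trans)
  open Preorder V using (_≲_)
  open PreorderReasoning V

  exchange-along-cycle :
    (∀ x y z → y ≤ₐ x → g y x z ≲ g x y z) →
    (∀ x y z → z ≤ₐ y → g x z y ≲ g x y z) →
    (∀ x y z → x ≤ₐ z → g z y x ≲ g x y z) →
    ∀ x y z → z ≤ₐ x → g z y x ≲ g x y z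
  exchange-along-cycle ex₁₂ ex₂₃ ex₃₁ x y z z≤x with total y z
  ... | inj₁ y≤z = begin
    g z y x  ≲⟨ ex₂₃ z x y (≤ₐ-trans y≤z z≤x) ⟩
    g z x y  ≲⟨ ex₃₁ y x z y≤z ⟩
    g y x z  ≲⟨ ex₁₂ x y z (≤ₐ-trans y≤z z≤x) ⟩
    g x y z  ∎
  ... | inj₂ z≤y with total y x
  ...   | inj₁ y≤x = begin
    g z y x  ≲⟨ ex₁₂ y z x z≤y ⟩
    g y z x  ≲⟨ ex₂₃ y x z z≤x ⟩
    g y x z  ≲⟨ ex₁₂ x y z y≤x ⟩
    g x y z  ∎
  ...   | inj₂ x≤y = begin
    g z y x  ≲⟨ ex₁₂ y z x z≤y ⟩
    g y z x  ≲⟨ ex₃₁ x z y x≤y ⟩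
    g x z y  ≲⟨ ex₂₃ x y z z≤y ⟩
    g x y z  ∎

module _ {n m : ℕ} where

  move-cong : ∀ {x y : Profile n m} p a → x ≗ y → move x p a ≗ move y p a
  move-cong {x} {y} p a x≗y i with i ≟ p
  ... | yes refl = trans (updateAt-updates p x) (sym (updateAt-updates p y))
  ... | no i≢p = trans (updateAt-minimal i p x i≢p)
                       (trans (x≗y i) (sym (updateAt-minimal i p y i≢p)))

  move-id : ∀ (x : Profile n m) {p a} → x p ≡ a → move x p a ≗ x
  move-id x {p} xp≡a = updateAt-id-local p x (sym xp≡a)

  move-move : ∀ (x : Profile n m) p a b → move (move x p a) p b ≗ move x p b
  move-move x p a b = updateAt-updateAt-local p x refl

  move-comm : ∀ (x : Profile n m) {p q} a b → p ≢ q →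
              move (move x p a) q b ≗ move (move x q b) p a
  move-comm x a b p≢q = updateAt-commutes _ _ (p≢q ∘ sym) x

  move-to-front : ∀ (x : Profile n m) {p q t} a b c → p ≢ t → q ≢ t →
                  move (move (move x p a) q b) t c ≗ move (move (move x t c) p a) q b
  move-to-front x {p} {q} a b c p≢t q≢t i =
    trans (move-comm (move x p a) b c q≢t i)
          (move-cong q b (move-comm x a c p≢t) i)

module Ladder {c ℓ₁ ℓ₂} (O : TotalOrder c ℓ₁ ℓ₂) {n m : ℕ}
              (f : Profile n m → TotalOrder.Carrier O) (mono : Monotonic O f) where
  open TotalOrder O using (preorder) renaming (_≤_ to _≤ᵥ_; refl to ≤ᵥ-refl; trans to ≤ᵥ-trans)

  f-resp-≗ : ∀ {x z : Profile n m} → x ≗ z → f x ≤ᵥ f z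
  f-resp-≗ x≗z = mono _ _ (Fin.≤-reflexive ∘ x≗z)

  ExchangeDom : Rel (Fin n) ℓ₂
  ExchangeDom p q = ∀ (x : Profile n m) {a b} → b ≤ᶠ a →
                    f (move (move x p b) q a) ≤ᵥ f (move (move x p a) q b)

  Dom-refl : Reflexive (Dom O f)
  Dom-refl _ _ _ _ _ _ = ≤ᵥ-refl

  Dom⇒ExchangeDom : ∀ {p q} → p ≢ q → Dom O f p q → ExchangeDom p q
  Dom⇒ExchangeDom {p} {q} p≢q p⪰q x {a} {b} b≤a with b ≟ a
  ... | yes refl = ≤ᵥ-refl
  ... | no b≢a = ≤ᵥ-trans (f-resp-≗ (sym ∘ raise-q)) (≤ᵥ-trans (p⪰q a b b<a w wp wq) (f-resp-≗ raise-p))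
    where
    b<a = Fin.≤∧≢⇒< b≤a b≢a
    w = move (move x p b) q b
    wp : w p ≡ b
    wp = trans (updateAt-minimal p q _ p≢q) (updateAt-updates p x)
    wq : w q ≡ b
    wq = updateAt-updates q (move x p b)
    raise-q : move w q a ≗ move (move x p b) q a
    raise-q = move-move (move x p b) q b a
    raise-p : move w p a ≗ move (move x p a) q b
    raise-p i = trans (move-comm (move x p b) b a (p≢q ∘ sym) i)
                      (move-cong q b (move-move x p b a) i)

  ExchangeDom⇒Dom : ∀ {p q} → p ≢ q → ExchangeDom p q → Dom O f p q
  ExchangeDom⇒Dom {p} {q} p≢q p⪰ₓq r s s<r x xp≡s xq≡s =
    ≤ᵥ-trans (f-resp-≗ (sym ∘ raise-q)) (≤ᵥ-trans (p⪰ₓq x (<⇒≤ s<r)) (f-resp-≗ raise-p))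
    where
    raise-q : move (move x p s) q r ≗ move x q r
    raise-q = move-cong q r (move-id x xp≡s)
    raise-p : move (move x p r) q s ≗ move x p r
    raise-p = move-id (move x p r) (trans (updateAt-minimal q p x (p≢q ∘ sym)) xq≡s)

  ExchangeDom-trans : ∀ {p q t} → p ≢ q → q ≢ t → p ≢ t →
                      ExchangeDom p q → ExchangeDom q t → ExchangeDom t p → ExchangeDom p t
  ExchangeDom-trans {p} {q} {t} p≢q q≢t p≢t p⪰ₓq q⪰ₓt t⪰ₓp x {a} {b} b≤a =
    ≤ᵥ-trans (f-resp-≗ (sym ∘ fix-q b a))
      (≤ᵥ-trans (exchange-along-cycle (TotalOrder.totalPreorder (Fin.≤-totalOrder m)) preorder g ex₁₂ ex₂₃ ex₃₁ a (x q) b b≤a)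
                (f-resp-≗ (fix-q a b)))
    where
    g : Fin m → Fin m → Fin m → _
    g α β γ = f (move (move (move x p α) q β) t γ)
    ex₁₂ : ∀ α β γ → β ≤ᶠ α → g β α γ ≤ᵥ g α β γ
    ex₁₂ α β γ β≤α = ≤ᵥ-trans (f-resp-≗ (move-to-front x β α γ p≢t q≢t))
      (≤ᵥ-trans (p⪰ₓq (move x t γ) β≤α) (f-resp-≗ (sym ∘ move-to-front x α β γ p≢t q≢t)))
    ex₂₃ : ∀ α β γ → γ ≤ᶠ β → g α γ β ≤ᵥ g α β γ
    ex₂₃ α β γ = q⪰ₓt (move x p α)
    rotate : ∀ α β γ → move (move (move x p α) q β) t γ ≗ move (move (move x q β) t γ) p α
    rotate α β γ i = trans (move-to-front x α β γ p≢t q≢t i)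
                           (move-to-front x γ α β (q≢t ∘ sym) p≢q i)
    ex₃₁ : ∀ α β γ → α ≤ᶠ γ → g γ β α ≤ᵥ g α β γ
    ex₃₁ α β γ α≤γ = ≤ᵥ-trans (f-resp-≗ (rotate γ β α))
      (≤ᵥ-trans (t⪰ₓp (move x q β) α≤γ) (f-resp-≗ (sym ∘ rotate α β γ)))
    fix-q : ∀ α γ → move (move (move x p α) q (x q)) t γ ≗ move (move x p α) t γ
    fix-q α γ = move-cong t γ (move-id (move x p α) (updateAt-minimal q p x (p≢q ∘ sym)))

  Dom-trans : Linear O f → Transitive (Dom O f)
  Dom-trans linear {p} {q} {t} p⪰q q⪰t with linear p t
  ... | inj₁ p⪰t = p⪰t
  ... | inj₂ t⪰p with p ≟ q | q ≟ t | p ≟ t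
  ...   | yes refl | _        | _        = q⪰t
  ...   | no _     | yes refl | _        = p⪰q
  ...   | no _     | no _     | yes refl = Dom-refl
  ...   | no p≢q   | no q≢t   | no p≢t   =
    ExchangeDom⇒Dom p≢t (ExchangeDom-trans p≢q q≢t p≢t
      (Dom⇒ExchangeDom p≢q p⪰q) (Dom⇒ExchangeDom q≢t q⪰t) (Dom⇒ExchangeDom (p≢t ∘ sym) t⪰p))

module _ {a ℓ} {A : Set a} (S : Rel A ℓ) where

  Edge : A → A → Rel A (a ⊔ ℓ)
  Edge p q u v = u ≡ p × v ≡ q × S p q

  Edge-isTournament : (∀ x → ¬ S x x) → ∀ p q → IsTournament (Edge p q)
  Edge-isTournament irrefl p q = asym , complete
    where
    asym : ∀ {u v} → Edge p q u v → ¬ Edge p q v u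
    asym (refl , refl , Spq) (refl , _ , _) = irrefl _ Spq
    endpoint : ∀ {u} → InField (Edge p q) u → (u ≡ p ⊎ u ≡ q) × S p q
    endpoint (_ , inj₁ (u≡p , _ , Spq)) = inj₁ u≡p , Spq
    endpoint (_ , inj₂ (_ , u≡q , Spq)) = inj₂ u≡q , Spq
    complete : ∀ u v → InField (Edge p q) u → InField (Edge p q) v → u ≢ v →
               Edge p q u v ⊎ Edge p q v u
    complete u v u∈ v∈ u≢v with endpoint u∈ | endpoint v∈
    ... | inj₁ refl , _   | inj₁ refl , _ = ⊥-elim (u≢v refl)
    ... | inj₁ u≡p  , Spq | inj₂ v≡q  , _ = inj₁ (u≡p , v≡q , Spq)
    ... | inj₂ u≡q  , Spq | inj₁ v≡p  , _ = inj₂ (v≡p , u≡q , Spq)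
    ... | inj₂ refl , _   | inj₂ refl , _ = ⊥-elim (u≢v refl)

irreflexive⇒finiteUnionOfTournaments : ∀ {ℓ n} (S : Rel (Fin n) ℓ) → (∀ x → ¬ S x x) →
                                       FiniteUnionOfTournaments S
irreflexive⇒finiteUnionOfTournaments {n = n} S irrefl =
  n * n , edge , (λ i → Edge-isTournament S irrefl _ _) , λ x y → covers x y , included x y
  where
  edge : Fin (n * n) → Rel (Fin n) _
  edge i = uncurry (Edge S) (remQuot n i)
  covers : ∀ x y → S x y → ∃[ i ] edge i x y
  covers x y Sxy = combine x y ,
    subst (λ pq → uncurry (Edge S) pq x y) (sym (Fin.remQuot-combine x y)) (refl , refl , Sxy)
  included : ∀ x y → ∃[ i ] edge i x y → S x y
  included x y (_ , refl , refl , Sxy) = Sxy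

theorem1 : ∀ {c ℓ₁ ℓ₂} (O : TotalOrder c ℓ₁ ℓ₂) (n m : ℕ) → 1 ≤ n → 2 ≤ m →
           (f : Profile n m → TotalOrder.Carrier O) →
           Monotonic O f → Linear O f →
           IsCompletePreorder (Dom O f) × FiniteUnionOfTournaments (SDom O f)
theorem1 O n m _ _ f mono linear =
  (linear , Dom-refl , Dom-trans linear) ,
  irreflexive⇒finiteUnionOfTournaments (SDom O f) (λ _ (p⪰p , p⋡p) → p⋡p p⪰p)
  where open Ladder O f mono
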